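{- For any two graphs $G$ and $H$, \[ \mathrm{oh}(G\circ H)\geq \mathrm{oh}(G\boxtimes H)\geq \begin{cases}\Delta(G)+1, & \text{if } \Delta(G)=\Delta(H),\\ \min\{\Delta(G),\Delta(H)\}+2, & \text{otherwise,}\end{cases} \] where $G\circ H$ denotes the lexicographic product and $G\boxtimes H$ the strong product.
   Context: All graphs are finite, simple and loopless; $\Delta(G)$ is the maximum degree. $\mathrm{oh}(G)$ (Odd Hadwiger number) is the largest integer $m$ for which there exist $m$ pairwise vertex-disjoint trees $Z_1,\dots,Z_m$ in $G$ and a 2-colouring $c$ of $V(Z_1)\cup\dots\cup V(Z_m)$ that is proper on each $Z_k$, such that for every $k\neq k'$ there is an edge $xy\in E(G)$ with $x\in V(Z_k)$, $y\in V(Z_{k'})$, $c(x)=c(y)$. Both products have vertex set $V(G)\times V(H)$. Lexicographic product: $(v_1,u_1)\sim(v_2,u_2)$ iff $v_1v_2\in E(G)$, or ($v_1=v_2$ and $u_1u_2\in E(H)$). Strong product: $(v_1,u_1)\sim(v_2,u_2)$ iff ($v_1=v_2$ and $u_1u_2\in E(H)$), or ($u_1=u_2$ and $v_1v_2\in E(G)$), or ($v_1v_2\in E(G)$ and $u_1u_2\in E(H)$). -}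

module Defs where

open import Data.Nat using (ℕ; zero; suc; _+_; _<_; _≤_; _⊔_; _⊓_; _≡ᵇ_)
open import Data.Bool using (Bool; true; false; if_then_else_)
open import Data.Fin using (Fin)
open import Data.List using (List; map; foldr; allFin)
open import Data.Nat.ListAction using (sum)
open import Data.Maybe using (Maybe; just; nothing)
open import Data.Product using (_×_; _,_; Σ; ∃; ∃-syntax)
open import Data.Sum using (_⊎_)
open import Relation.Binary.PropositionalEquality using (_≡_; _≢_)

record Graph : Set where
  field
    n     : ℕ
    adj   : Fin n → Fin n → Bool
    sym   : ∀ v w → adj v w ≡ adj w v
    irrefl : ∀ v → adj v v ≡ false

open Graph public

E : (G : Graph) → Fin (n G) → Fin (n G) → Set
E G v w = adj G v w ≡ true

deg : (G : Graph) → Fin (n G) → ℕ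
deg G v = sum (map (λ w → if adj G v w then 1 else 0) (allFin (n G)))

-- maximum degree Δ(G) (0 for the empty graph)
Δ : Graph → ℕ
Δ G = foldr _⊔_ 0 (map (deg G) (allFin (n G)))

LexE : (G H : Graph) → Fin (n G) × Fin (n H) → Fin (n G) × Fin (n H) → Set
LexE G H (v₁ , u₁) (v₂ , u₂) = E G v₁ v₂ ⊎ (v₁ ≡ v₂ × E H u₁ u₂)

StrongE : (G H : Graph) → Fin (n G) × Fin (n H) → Fin (n G) × Fin (n H) → Set
StrongE G H (v₁ , u₁) (v₂ , u₂) =
  (v₁ ≡ v₂ × E H u₁ u₂) ⊎ ((u₁ ≡ u₂ × E G v₁ v₂) ⊎ (E G v₁ v₂ × E H u₁ u₂))

-- Each vertex lies in at most one branch tree (branch v = just k means v ∈ Z_k),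
-- so the trees are pairwise vertex-disjoint.  Tree Z_k is given as a rooted tree:
-- root k, and every other vertex v of Z_k has a parent in Z_k adjacent to it, with
-- strictly smaller depth; the tree edges are exactly {v, parent v}.
record OddMinor (V : Set) (Ed : V → V → Set) (m : ℕ) : Set where
  field
    branch  : V → Maybe (Fin m)
    colour  : V → Bool
    root    : Fin m → V
    root-in : ∀ k → branch (root k) ≡ just k
    parent  : V → V
    depth   : V → ℕ
    tree    : ∀ v k → branch v ≡ just k → v ≢ root k →
                branch (parent v) ≡ just k × Ed v (parent v) ×
                depth (parent v) < depth v × colour (parent v) ≢ colour v
    touch   : ∀ k k' → k ≢ k' → ∃[ x ] ∃[ y ]
                (branch x ≡ just k × branch y ≡ just k' × Ed x y × colour x ≡ colour y)

-- "oh(G ∘ H) ≥ m" and "oh(G ⊠ H) ≥ m"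
LexOddMinor : Graph → Graph → ℕ → Set
LexOddMinor G H = OddMinor (Fin (n G) × Fin (n H)) (LexE G H)

StrongOddMinor : Graph → Graph → ℕ → Set
StrongOddMinor G H = OddMinor (Fin (n G) × Fin (n H)) (StrongE G H)

bound : Graph → Graph → ℕ
bound G H = if Δ G ≡ᵇ Δ H then suc (Δ G) else (Δ G ⊓ Δ H) + 2

{-# OPTIONS --safe #-}
-- Fix v ∈ G, u ∈ H, distinct neighbours x₁ … x_c of v and y₀ … y_c of u.  In G ⊠ H take
-- the trees {(v , u)}, {(v , y₀)} and, for i ≥ 1, the tree rooted at (v , y_i) whose only
-- child is (x_i , u), which in turn is the parent of every (x_i , q) with q ~ u.  Colour
-- the vertices (x_i , u) false and all others true.  Then (v , u) ~ (v , y_j) and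
-- (x_i , y_j) ~ (v , y_j) are monochromatic edges joining any two trees, so
-- oh(G ⊠ H) ≥ 1 + min(deg v + 1, deg u).  Vertices of maximum degree, with the factors
-- swapped if needed, give the bound; and every edge of G ⊠ H is an edge of G ∘ H.
module Submission where

open import Defs hiding (sym)
open import Data.Bool using (Bool; true; false; if_then_else_; T)
open import Data.Bool.Properties using () renaming (_≟_ to _≟ᵇ_)
open import Data.Empty using (⊥-elim)
open import Data.Fin using (Fin; zero; suc; inject≤; fromℕ<)
open import Data.Fin.Properties using (_≟_; any?; inject≤-injective)
open import Data.List using (List; []; _∷_; map; filter; length; lookup; allFin)
open import Data.List.Membership.Propositional.Properties
  using (∈-map⁻; ∈-filter⁻; ∈-lookup; foldr-selective)
import Data.List.Relation.Unary.All as All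
open import Data.List.Relation.Unary.AllPairs using (_∷_)
open import Data.List.Relation.Unary.Unique.Propositional using (Unique)
open import Data.List.Relation.Unary.Unique.Propositional.Properties using (allFin⁺; filter⁺)
open import Data.Maybe using (Maybe; just; nothing)
import Data.Maybe as Maybe
open import Data.Nat using (ℕ; zero; suc; _+_; _≤_; _<_; _⊓_; _≡ᵇ_; z≤n; s≤s)
open import Data.Nat.ListAction using (sum)
open import Data.Nat.Properties
  using (⊔-sel; ≤-refl; ≤-trans; ≤-reflexive; n≤1+n; <⇒≤; +-comm; <-cmp;
         ≡ᵇ⇒≡; ≡⇒≡ᵇ; m≤n⇒m⊓n≡m; m≥n⇒m⊓n≡n)
open import Data.Product using (_×_; _,_; proj₂; ∃-syntax; swap)
open import Data.Product.Properties using (≡-dec)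
open import Data.Sum using (_⊎_; inj₁; inj₂)
open import Data.Unit using (tt)
open import Function using (_∘_)
open import Function.Definitions using (Injective)
open import Relation.Binary using (DecidableEquality; tri<; tri≈; tri>)
open import Relation.Nullary using (yes; no)
open import Relation.Unary using (Decidable)
open import Relation.Binary.PropositionalEquality

E-sym : (G : Graph) {a b : Fin (n G)} → E G a b → E G b a
E-sym G {a} {b} e = trans (Graph.sym G b a) e

E-irrefl : (G : Graph) {a b : Fin (n G)} → E G a b → a ≢ b
E-irrefl G {a} e refl with trans (sym e) (irrefl G a)
... | ()

StrongE-sym : (G H : Graph) {a b : Fin (n G) × Fin (n H)} → StrongE G H a b → StrongE G H b a
StrongE-sym G H (inj₁ (refl , e)) = inj₁ (refl , E-sym H e)
StrongE-sym G H (inj₂ (inj₁ (refl , e))) = inj₂ (inj₁ (refl , E-sym G e))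
StrongE-sym G H (inj₂ (inj₂ (e , f))) = inj₂ (inj₂ (E-sym G e , E-sym H f))

StrongE-swap : (G H : Graph) {a b : Fin (n G) × Fin (n H)} →
  StrongE H G (swap a) (swap b) → StrongE G H a b
StrongE-swap G H (inj₁ e) = inj₂ (inj₁ e)
StrongE-swap G H (inj₂ (inj₁ e)) = inj₁ e
StrongE-swap G H (inj₂ (inj₂ (e , f))) = inj₂ (inj₂ (f , e))

StrongE⇒LexE : (G H : Graph) {a b : Fin (n G) × Fin (n H)} → StrongE G H a b → LexE G H a b
StrongE⇒LexE G H (inj₁ e) = inj₂ e
StrongE⇒LexE G H (inj₂ (inj₁ (_ , e))) = inj₁ e
StrongE⇒LexE G H (inj₂ (inj₂ (e , _))) = inj₁ e

sum-indicator≡length-filter : {A : Set} (b : A → Bool) (xs : List A) →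
  sum (map (λ x → if b x then 1 else 0) xs) ≡ length (filter (λ x → b x ≟ᵇ true) xs)
sum-indicator≡length-filter b [] = refl
sum-indicator≡length-filter b (x ∷ xs) with b x
... | true = cong suc (sum-indicator≡length-filter b xs)
... | false = sum-indicator≡length-filter b xs

lookup-injective : {A : Set} {xs : List A} → Unique xs → Injective _≡_ _≡_ (lookup xs)
lookup-injective {xs = _ ∷ _} _ {zero} {zero} _ = refl
lookup-injective (x∉xs ∷ _) {zero} {suc j} eq = ⊥-elim (All.lookup x∉xs (∈-lookup j) eq)
lookup-injective (x∉xs ∷ _) {suc i} {zero} eq = ⊥-elim (All.lookup x∉xs (∈-lookup i) (sym eq))
lookup-injective (_ ∷ unique) {suc i} {suc j} eq = cong suc (lookup-injective unique eq)

module _ {c m : ℕ} (f : Fin c → Fin m) where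

  preimage : Fin m → Maybe (Fin c)
  preimage q with any? (λ j → f j ≟ q)
  ... | yes (j , _) = just j
  ... | no _ = nothing

  preimage-sound : ∀ {q j} → preimage q ≡ just j → f j ≡ q
  preimage-sound {q} with any? (λ j → f j ≟ q)
  ... | yes (j , fj≡q) = λ { refl → fj≡q }
  ... | no _ = λ ()

  preimage-complete : Injective _≡_ _≡_ f → ∀ j → preimage (f j) ≡ just j
  preimage-complete f-inj j with any? (λ i → f i ≟ f j)
  ... | yes (i , fi≡fj) = cong just (f-inj fi≡fj)
  ... | no ∄i = ⊥-elim (∄i (j , refl))

adjacent? : (G : Graph) (v : Fin (n G)) → Decidable (E G v)
adjacent? G v w = adj G v w ≟ᵇ true

neighbours : (G : Graph) → Fin (n G) → List (Fin (n G))
neighbours G v = filter (adjacent? G v) (allFin (n G))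

deg≡length-neighbours : (G : Graph) (v : Fin (n G)) → deg G v ≡ length (neighbours G v)
deg≡length-neighbours G v = sum-indicator≡length-filter (adj G v) (allFin (n G))

record DistinctNeighbours (G : Graph) (v : Fin (n G)) (c : ℕ) : Set where
  field
    neighbour : Fin c → Fin (n G)
    injective : Injective _≡_ _≡_ neighbour
    adjacent  : ∀ j → E G v (neighbour j)

  index : Fin (n G) → Maybe (Fin c)
  index = preimage neighbour

  index-sound : ∀ {p j} → index p ≡ just j → neighbour j ≡ p
  index-sound = preimage-sound neighbour

  index-neighbour : ∀ j → index (neighbour j) ≡ just j
  index-neighbour = preimage-complete neighbour injective

  neighbour≢centre : ∀ j → neighbour j ≢ v
  neighbour≢centre j = E-irrefl G (adjacent j) ∘ sym

distinctNeighbours : (G : Graph) (v : Fin (n G)) {c : ℕ} → c ≤ deg G v → DistinctNeighbours G v c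
distinctNeighbours G v {c} c≤deg = record
  { neighbour = λ j → lookup ns (inject≤ j c≤len)
  ; injective = inject≤-injective c≤len c≤len _ _ ∘ lookup-injective ns-unique
  ; adjacent  = λ j → proj₂ (∈-filter⁻ (adjacent? G v) {xs = allFin (n G)} (∈-lookup (inject≤ j c≤len)))
  }
  where
  ns : List (Fin (n G))
  ns = neighbours G v
  ns-unique : Unique ns
  ns-unique = filter⁺ (adjacent? G v) (allFin⁺ (n G))
  c≤len : c ≤ length ns
  c≤len = subst (c ≤_) (deg≡length-neighbours G v) c≤deg

maxDegreeVertex : (G : Graph) → 1 ≤ n G → ∃[ v ] Δ G ≤ deg G v
maxDegreeVertex G 1≤n with foldr-selective ⊔-sel 0 (map (deg G) (allFin (n G)))
... | inj₁ Δ≡0 = fromℕ< 1≤n , subst (_≤ deg G (fromℕ< 1≤n)) (sym Δ≡0) z≤n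
... | inj₂ Δ∈degs with ∈-map⁻ (deg G) Δ∈degs
...   | v , _ , Δ≡deg = v , ≤-reflexive Δ≡deg

OddMinor-mono : {V : Set} {Ed Ed′ : V → V → Set} {m : ℕ} →
  (∀ {a b} → Ed a b → Ed′ a b) → OddMinor V Ed m → OddMinor V Ed′ m
OddMinor-mono Ed⊆Ed′ M = record
  { branch = branch ; colour = colour ; root = root ; root-in = root-in
  ; parent = parent ; depth = depth
  ; tree  = λ w k w∈k w≢root → let (p∈k , e , shallower , flip) = tree w k w∈k w≢root
                               in p∈k , Ed⊆Ed′ e , shallower , flip
  ; touch = λ k k′ k≢k′ → let (a , b , a∈k , b∈k′ , e , same) = touch k k′ k≢k′
                          in a , b , a∈k , b∈k′ , Ed⊆Ed′ e , same
  }
  where open OddMinor M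

oddMinor-singleton : {V : Set} {Ed : V → V → Set} → DecidableEquality V → V → OddMinor V Ed 1
oddMinor-singleton {V} _≟ⱽ_ w = record
  { branch = branch ; colour = λ _ → true ; root = λ _ → w ; root-in = λ { zero → branch-w }
  ; parent = λ x → x ; depth = λ _ → 0
  ; tree  = λ x _ x∈ x≢w → ⊥-elim (x≢w (branch-sole x x∈))
  ; touch = λ { zero zero 0≢0 → ⊥-elim (0≢0 refl) }
  }
  where
  branch : V → Maybe (Fin 1)
  branch x with x ≟ⱽ w
  ... | yes _ = just zero
  ... | no _ = nothing

  branch-w : branch w ≡ just zero
  branch-w with w ≟ⱽ w
  ... | yes _ = refl
  ... | no w≢w = ⊥-elim (w≢w refl)

  branch-sole : ∀ x {k} → branch x ≡ just k → x ≡ w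
  branch-sole x with x ≟ⱽ w
  ... | yes x≡w = λ _ → x≡w
  ... | no _ = λ ()

strongOddMinor-swap : (G H : Graph) {m : ℕ} → StrongOddMinor H G m → StrongOddMinor G H m
strongOddMinor-swap G H M = record
  { branch = branch ∘ swap ; colour = colour ∘ swap ; root = swap ∘ root ; root-in = root-in
  ; parent = swap ∘ parent ∘ swap ; depth = depth ∘ swap
  ; tree  = λ w k w∈k w≢root →
      let (p∈k , e , shallower , flip) = tree (swap w) k w∈k (w≢root ∘ cong swap)
      in p∈k , StrongE-swap G H e , shallower , flip
  ; touch = λ k k′ k≢k′ → let (a , b , a∈k , b∈k′ , e , same) = touch k k′ k≢k′
                          in swap a , swap b , a∈k , b∈k′ , StrongE-swap G H e , same
  }
  where open OddMinor M

module HubConstruction (G H : Graph) (v : Fin (n G)) (u : Fin (n H)) {c : ℕ}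
  (X : DistinctNeighbours G v c) (Y : DistinctNeighbours H u (suc c)) where

  open DistinctNeighbours X using ()
    renaming (neighbour to x; index to x⁻¹; index-sound to x⁻¹-sound;
              index-neighbour to x⁻¹-x; adjacent to x-adjacent; neighbour≢centre to x≢v)
  open DistinctNeighbours Y using ()
    renaming (neighbour to y; index to y⁻¹; index-sound to y⁻¹-sound;
              index-neighbour to y⁻¹-y; adjacent to y-adjacent; neighbour≢centre to y≢u)

  V : Set
  V = Fin (n G) × Fin (n H)

  data Role : Set where
    centre    : Role
    root      : Fin (suc c) → Role
    spoke rim : Fin c → Role

  data Placed : V → Role → Set where
    centre : Placed (v , u) centre
    root   : ∀ j → Placed (v , y j) (root j)
    spoke  : ∀ i → Placed (x i , u) (spoke i)
    rim    : ∀ i {q} → E H u q → Placed (x i , q) (rim i)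

  role : V → Maybe Role
  role (p , q) with p ≟ v | q ≟ u
  ... | yes _ | yes _ = just centre
  ... | yes _ | no _  = Maybe.map root (y⁻¹ q)
  ... | no _  | yes _ = Maybe.map spoke (x⁻¹ p)
  ... | no _  | no _  = if adj H u q then Maybe.map rim (x⁻¹ p) else nothing

  role-sound : ∀ w {r} → role w ≡ just r → Placed w r
  role-sound (p , q) with p ≟ v | q ≟ u
  ... | yes refl | yes refl = λ { refl → centre }
  ... | yes refl | no _ with y⁻¹ q in q↦j
  ...   | just j = λ { refl → subst (λ q → Placed (v , q) (root j)) (y⁻¹-sound q↦j) (root j) }
  role-sound (p , q) | no _ | yes refl with x⁻¹ p in p↦i
  ...   | just i = λ { refl → subst (λ p → Placed (p , u) (spoke i)) (x⁻¹-sound p↦i) (spoke i) }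
  role-sound (p , q) | no _ | no _ with adj H u q in uq | x⁻¹ p in p↦i
  ...   | true | just i = λ { refl → subst (λ p → Placed (p , q) (rim i)) (x⁻¹-sound p↦i) (rim i uq) }

  role-complete : ∀ {w r} → Placed w r → role w ≡ just r
  role-complete centre with v ≟ v | u ≟ u
  ... | yes _ | yes _ = refl
  ... | no v≢v | _ = ⊥-elim (v≢v refl)
  ... | _ | no u≢u = ⊥-elim (u≢u refl)
  role-complete (root j) with v ≟ v | y j ≟ u
  ... | yes _ | no _ = cong (Maybe.map root) (y⁻¹-y j)
  ... | no v≢v | _ = ⊥-elim (v≢v refl)
  ... | _ | yes yj≡u = ⊥-elim (y≢u j yj≡u)
  role-complete (spoke i) with x i ≟ v | u ≟ u
  ... | no _ | yes _ = cong (Maybe.map spoke) (x⁻¹-x i)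
  ... | yes xi≡v | _ = ⊥-elim (x≢v i xi≡v)
  ... | _ | no u≢u = ⊥-elim (u≢u refl)
  role-complete (rim i {q} uq) with x i ≟ v | q ≟ u
  ... | no _ | no _ rewrite uq = cong (Maybe.map rim) (x⁻¹-x i)
  ... | yes xi≡v | _ = ⊥-elim (x≢v i xi≡v)
  ... | _ | yes refl = ⊥-elim (E-irrefl H uq refl)

  Tree : Set
  Tree = Fin (2 + c)

  treeOf : Role → Tree
  treeOf centre    = zero
  treeOf (root j)  = suc j
  treeOf (spoke i) = suc (suc i)
  treeOf (rim i)   = suc (suc i)

  depthOf : Role → ℕ
  depthOf (spoke _) = 1
  depthOf (rim _)   = 2
  depthOf _         = 0

  colourOf : Role → Bool
  colourOf (spoke _) = false
  colourOf _         = true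

  parentOf : V → Role → V
  parentOf _       (spoke i) = v , y (suc i)
  parentOf (p , _) (rim _)   = p , u
  parentOf w       _         = w

  branch : V → Maybe Tree
  branch w = Maybe.map treeOf (role w)

  colour : V → Bool
  colour w = Maybe.maybe colourOf true (role w)

  depth : V → ℕ
  depth w = Maybe.maybe depthOf 0 (role w)

  parent : V → V
  parent w = Maybe.maybe (parentOf w) w (role w)

  rootOf : Tree → V
  rootOf zero    = v , u
  rootOf (suc j) = v , y j

  branch-rootOf : ∀ k → branch (rootOf k) ≡ just k
  branch-rootOf zero    = cong (Maybe.map treeOf) (role-complete centre)
  branch-rootOf (suc j) = cong (Maybe.map treeOf) (role-complete (root j))

  toward-root : ∀ w k → branch w ≡ just k → w ≢ rootOf k →
    branch (parent w) ≡ just k × StrongE G H w (parent w) ×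
    depth (parent w) < depth w × colour (parent w) ≢ colour w
  toward-root w k w∈k w≢root with role w in w↦r
  toward-root w k refl w≢root | just r with role-sound w w↦r
  ... | centre = ⊥-elim (w≢root refl)
  ... | root j = ⊥-elim (w≢root refl)
  ... | spoke i rewrite role-complete (root (suc i)) =
    refl , inj₂ (inj₂ (E-sym G (x-adjacent i) , y-adjacent (suc i))) , s≤s z≤n , λ ()
  ... | rim i uq rewrite role-complete (spoke i) =
    refl , inj₁ (refl , E-sym H uq) , s≤s (s≤s z≤n) , λ ()

  Joined : Tree → Tree → Set
  Joined k k′ = ∃[ a ] ∃[ b ]
    (branch a ≡ just k × branch b ≡ just k′ × StrongE G H a b × colour a ≡ colour b)

  joined-sym : ∀ {k k′} → Joined k k′ → Joined k′ k
  joined-sym (a , b , a∈k , b∈k′ , e , same) = b , a , b∈k′ , a∈k , StrongE-sym G H e , sym same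

  placed-joined : ∀ {a b r s} → Placed a r → Placed b s → StrongE G H a b →
    colourOf r ≡ colourOf s → Joined (treeOf r) (treeOf s)
  placed-joined {a} {b} a∶r b∶s e same = a , b , a∈ , b∈ , e , same′
    where
    a∈ : branch a ≡ just _
    a∈ = cong (Maybe.map treeOf) (role-complete a∶r)
    b∈ : branch b ≡ just _
    b∈ = cong (Maybe.map treeOf) (role-complete b∶s)
    same′ : colour a ≡ colour b
    same′ rewrite role-complete a∶r | role-complete b∶s = same

  joined : ∀ k k′ → k ≢ k′ → Joined k k′
  joined zero zero 0≢0 = ⊥-elim (0≢0 refl)
  joined zero (suc j) _ = placed-joined centre (root j) (inj₁ (refl , y-adjacent j)) refl
  joined (suc j) zero _ = joined-sym (joined zero (suc j) λ ())
  joined (suc (suc i)) (suc j) _ =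
    placed-joined (rim i (y-adjacent j)) (root j) (inj₂ (inj₁ (refl , E-sym G (x-adjacent i)))) refl
  joined (suc zero) (suc zero) 1≢1 = ⊥-elim (1≢1 refl)
  joined (suc zero) (suc (suc i)) _ = joined-sym (joined (suc (suc i)) (suc zero) λ ())

  oddMinor : StrongOddMinor G H (2 + c)
  oddMinor = record
    { branch = branch ; colour = colour ; root = rootOf ; root-in = branch-rootOf
    ; parent = parent ; depth = depth ; tree = toward-root ; touch = joined }

strongOddMinor-deg : (G H : Graph) (v : Fin (n G)) (u : Fin (n H)) {c : ℕ} →
  c ≤ suc (deg G v) → c ≤ deg H u → StrongOddMinor G H (suc c)
strongOddMinor-deg G H v u {zero} _ _ = oddMinor-singleton (≡-dec _≟_ _≟_) (v , u)
strongOddMinor-deg G H v u {suc c} (s≤s c≤deg) 1+c≤deg =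
  HubConstruction.oddMinor G H v u (distinctNeighbours G v c≤deg) (distinctNeighbours H u 1+c≤deg)

strongOddMinor-Δ : (G H : Graph) → 1 ≤ n G → 1 ≤ n H → {c : ℕ} →
  c ≤ suc (Δ G) → c ≤ Δ H → StrongOddMinor G H (suc c)
strongOddMinor-Δ G H 1≤|G| 1≤|H| c≤1+ΔG c≤ΔH
  with maxDegreeVertex G 1≤|G| | maxDegreeVertex H 1≤|H|
... | v , ΔG≤deg | u , ΔH≤deg =
  strongOddMinor-deg G H v u (≤-trans c≤1+ΔG (s≤s ΔG≤deg)) (≤-trans c≤ΔH ΔH≤deg)

bound-witness : ∀ a b → ∃[ c ] suc c ≡ (if a ≡ᵇ b then suc a else a ⊓ b + 2) ×
  ((c ≤ suc a × c ≤ b) ⊎ (c ≤ suc b × c ≤ a))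
bound-witness a b with a ≡ᵇ b in a≡ᵇb
... | true = a , refl , inj₁ (n≤1+n a , ≤-reflexive (≡ᵇ⇒≡ a b (subst T (sym a≡ᵇb) tt)))
... | false with <-cmp a b
...   | tri< a<b _ _ = suc a , trans (+-comm 2 a) (cong (_+ 2) (sym (m≤n⇒m⊓n≡m (<⇒≤ a<b)))) ,
                       inj₁ (≤-refl , a<b)
...   | tri> _ _ b<a = suc b , trans (+-comm 2 b) (cong (_+ 2) (sym (m≥n⇒m⊓n≡n (<⇒≤ b<a)))) ,
                       inj₂ (≤-refl , b<a)
...   | tri≈ _ a≡b _ = ⊥-elim (subst T a≡ᵇb (≡⇒≡ᵇ a b a≡b))

theorem4 : (G H : Graph) → 1 ≤ n G → 1 ≤ n H →
    ((∀ m → StrongOddMinor G H m → LexOddMinor G H m) ×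
     StrongOddMinor G H (bound G H))
theorem4 G H 1≤|G| 1≤|H| = (λ _ → OddMinor-mono (StrongE⇒LexE G H)) , lower-bound
  where
  lower-bound : StrongOddMinor G H (bound G H)
  lower-bound with bound-witness (Δ G) (Δ H)
  ... | c , 1+c≡bound , inj₁ (c≤1+ΔG , c≤ΔH) =
    subst (StrongOddMinor G H) 1+c≡bound (strongOddMinor-Δ G H 1≤|G| 1≤|H| c≤1+ΔG c≤ΔH)
  ... | c , 1+c≡bound , inj₂ (c≤1+ΔH , c≤ΔG) =
    subst (StrongOddMinor G H) 1+c≡bound
      (strongOddMinor-swap G H (strongOddMinor-Δ H G 1≤|H| 1≤|G| c≤1+ΔH c≤ΔG))
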